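{- Let $v$ be a positive integer and $e$ an integer with $3\le e\le\binom v2$, and let $e'=\binom v2-e$. Then $C(v,e)\ge L(e)$ and $S(v,e)\ge L(e')+(v-1)(4e-v(v-1))$, where $L(x)=x(\sqrt{8x+1}-1.5)$.
   Context: For $0\le e\le\binom v2$ write $e=\binom{k+1}2-j$ with integers $1\le j\le k$, and set $C(v,e)=j(k-1)^2+(k-j)k^2+(k-j)^2$ (the sum of squared degrees of the quasi-complete graph: a complete graph on $k$ vertices, one further vertex adjacent to $k-j$ of them, and isolated vertices). $S(v,e)$ is the sum of squared degrees of the quasi-star graph, the complement of the quasi-complete graph with $v$ vertices and $\binom v2-e$ edges; equivalently $S(v,e)=C(v,\binom v2-e)+(v-1)(4e-v(v-1))$. -}

module Defs where

open import Data.Nat as ℕ using (ℕ; zero; suc; _+_; _*_; _∸_; _≤ᵇ_)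
open import Data.Nat.Combinatorics using (_C_)
open import Data.Bool using (if_then_else_)
open import Data.Integer as ℤ using (ℤ; +_)
open import Data.Product using (_×_)

-- triangular numbers: tri k = binom (k+1) 2
tri : ℕ → ℕ
tri zero    = 0
tri (suc k) = tri k + suc k

cnt : ℕ → ℕ → ℕ
cnt e zero    = 0
cnt e (suc n) = cnt e n + (if tri (suc n) ≤ᵇ e then 1 else 0)

-- the unique k ≥ 1 with binom k 2 ≤ e < binom (k+1) 2
kOf : ℕ → ℕ
kOf e = suc (cnt e e)

-- j = binom (k+1) 2 - e, so that e = binom (k+1) 2 - j with 1 ≤ j ≤ k
jOf : ℕ → ℕ
jOf e = tri (kOf e) ∸ e

-- C(v,e): sum of squared degrees of the quasi-complete graph
-- (independent of v; v is kept as in the paper)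
Cqc : ℕ → ℕ → ℕ
Cqc v e = j * ((k ∸ 1) * (k ∸ 1)) + (k ∸ j) * (k * k) + (k ∸ j) * (k ∸ j)
  where
  k = kOf e
  j = jOf e

Sqs : ℕ → ℕ → ℤ
Sqs v e = (+ Cqc v ((v C 2) ∸ e))
          ℤ.+ (+ (v ∸ 1)) ℤ.* ((+ (4 * e)) ℤ.- (+ (v * (v ∸ 1))))

-- "a ≥ L(x)" where L(x) = x (√(8x+1) - 1.5), stated exactly over ℤ:
-- a ≥ x√(8x+1) - 3x/2  ⇔  2a + 3x ≥ 2x√(8x+1)
--                     ⇔  2a + 3x ≥ 0  and  (2a+3x)² ≥ 4x²(8x+1)
GeL : ℤ → ℕ → Set
GeL a x = (+ 0 ℤ.≤ t) × (+ (4 * (x * x) * (8 * x + 1)) ℤ.≤ t ℤ.* t)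
  where
  t = (+ 2) ℤ.* a ℤ.+ (+ (3 * x))

GeLPlus : ℤ → ℕ → ℤ → Set
GeLPlus a x b = GeL (a ℤ.- b) x

module Submission where

-- Write e = tri k - j with 1 ≤ j ≤ k, where tri k = binom (k+1) 2, and put
-- E = 2e.  Multiplied by 4, C ≥ e (√(8e+1) - 3/2) reads 4C + 3E ≥ 2E √(4E+1),
-- i.e. 4E²(4E+1) ≤ (4C + 3E)².  The square root is removed by the tangent-line
-- (AM-GM) estimate 2a √y ≤ a² + y at a = 2k + 1, which lies just above √(8e+1);
-- what remains is the polynomial inequality E (a² + 4E + 1) ≤ a (4C + 3E).  In
-- the coordinates p = j - 1 and q = k - j, which range freely over ℕ, the
-- difference of the two sides is 2(p+q)(p-q)² + p(p-1) + q² + 9q + 6pq ≥ 0.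
--
-- The bound for S is the bound
-- for C at e' = binom v 2 - e, as S(v,e) is C(v,e') plus exactly the offset.

open import Defs
open import Data.Nat using (ℕ; _≤_; _∸_; _*_)
open import Data.Nat.Combinatorics using (_C_)
open import Data.Integer as ℤ using (+_)
open import Data.Product using (_×_)

open import Data.Nat using (zero; suc; _+_; _<_; _≤ᵇ_; z≤n; s≤s; s≤s⁻¹; NonZero)
open import Data.Nat.Properties
open import Data.Nat.Tactic.RingSolver using (solve-∀)
open import Data.Product using (Σ; _,_)
open import Data.Sum using (_⊎_; inj₁; inj₂)
open import Data.Bool using (true; false)
open import Data.Empty using (⊥-elim)
open import Relation.Nullary.Reflects using (ofʸ; ofⁿ)
open import Relation.Binary.PropositionalEquality
import Data.Integer.Properties as ℤP
open import Algebra.Properties.AbelianGroup ℤP.+-0-abelianGroup using (//-rightDividesʳ)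

tri-mono : ∀ {m n} → m ≤ n → tri m ≤ tri n
tri-mono {zero}  {n}     _         = z≤n
tri-mono {suc m} {suc n} (s≤s m≤n) = +-mono-≤ (tri-mono m≤n) (s≤s m≤n)

tri-double : ∀ k → 2 * tri k ≡ k * suc k
tri-double zero    = refl
tri-double (suc k) = begin
  2 * (tri k + suc k)     ≡⟨ *-distribˡ-+ 2 (tri k) (suc k) ⟩
  2 * tri k + 2 * suc k   ≡⟨ cong (_+ 2 * suc k) (tri-double k) ⟩
  k * suc k + 2 * suc k   ≡⟨ step k ⟩
  suc k * suc (suc k)     ∎
  where
  open ≡-Reasoning
  step : ∀ k → k * (1 + k) + 2 * (1 + k) ≡ (1 + k) * (1 + (1 + k))
  step = solve-∀

-- c is the count of i ∈ [1..n] with tri i ≤ e: either all of [1..n] is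
-- counted, or c is the largest i with tri i ≤ e (tri is increasing, so the
-- counted i form an initial segment).
CountInvariant : ℕ → ℕ → ℕ → Set
CountInvariant e n c = c ≤ n × tri c ≤ e × (c ≡ n ⊎ e < tri (suc c))

cnt-invariant : ∀ e n → CountInvariant e n (cnt e n)
cnt-invariant e zero = z≤n , z≤n , inj₁ refl
cnt-invariant e (suc n)
  with cnt-invariant e n | tri (suc n) ≤ᵇ e | ≤ᵇ-reflects-≤ (tri (suc n)) e
... | c≤n , _ , full-or-max | true | ofʸ tsn≤e =
  subst (CountInvariant e (suc n)) (trans (+-comm 1 n) (cong (_+ 1) (sym (counted-all full-or-max))))
    (≤-refl , tsn≤e , inj₁ refl)
  where
  -- a gap below tri (suc n) would contradict tri (suc n) ≤ e
  counted-all : cnt e n ≡ n ⊎ e < tri (suc (cnt e n)) → cnt e n ≡ n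
  counted-all (inj₁ c≡n) = c≡n
  counted-all (inj₂ e<t) = ⊥-elim (<⇒≱ e<t (≤-trans (tri-mono (s≤s c≤n)) tsn≤e))
... | c≤n , tc≤e , full-or-max | false | ofⁿ tsn≰e =
  subst (CountInvariant e (suc n)) (sym (+-identityʳ (cnt e n)))
    (m≤n⇒m≤1+n c≤n , tc≤e , inj₂ (maximal full-or-max))
  where
  maximal : cnt e n ≡ n ⊎ e < tri (suc (cnt e n)) → e < tri (suc (cnt e n))
  maximal (inj₁ c≡n) rewrite c≡n = ≰⇒> tsn≰e
  maximal (inj₂ e<t) = e<t

-- kOf e - 1 = cnt e e is the c with tri c ≤ e < tri (c + 1); counting up to e
-- suffices because e < tri (e + 1).
cnt-bracket : ∀ e → tri (cnt e e) ≤ e × e < tri (suc (cnt e e))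
cnt-bracket e with cnt-invariant e e
... | _ , tc≤e , inj₁ c≡e rewrite c≡e = tc≤e , m≤n+m (suc e) (tri e)
... | _ , tc≤e , inj₂ e<t = tc≤e , e<t

gap-coordinates : ∀ c e → tri c ≤ e → e < tri (suc c) →
  Σ ℕ λ p → Σ ℕ λ q → c ≡ p + q × e ≡ tri (p + q) + q
gap-coordinates c e tc≤e e<t = c ∸ r , r , sym c≡p+r , e≡
  where
  r = e ∸ tri c
  e≡tc+r : e ≡ tri c + r
  e≡tc+r = sym (m+[n∸m]≡n tc≤e)
  r≤c : r ≤ c
  r≤c = s≤s⁻¹ (+-cancelˡ-< (tri c) r (suc c) (subst (_< tri (suc c)) e≡tc+r e<t))
  c≡p+r : c ∸ r + r ≡ c
  c≡p+r = m∸n+n≡m r≤c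
  e≡ : e ≡ tri (c ∸ r + r) + r
  e≡ = trans e≡tc+r (cong (λ x → tri x + r) (sym c≡p+r))

coordinates : ∀ e → Σ ℕ λ p → Σ ℕ λ q →
  kOf e ≡ suc (p + q) × jOf e ≡ suc p × e ≡ tri (p + q) + q
coordinates e with cnt-bracket e
... | tc≤e , e<t with gap-coordinates (cnt e e) e tc≤e e<t
...   | p , q , c≡p+q , e≡ = p , q , cong suc c≡p+q , j≡ , e≡
  where
  open ≡-Reasoning
  j≡ : jOf e ≡ suc p
  j≡ = begin
    tri (kOf e) ∸ e
      ≡⟨ cong₂ (λ k x → tri k ∸ x) (cong suc c≡p+q) e≡ ⟩
    (tri (p + q) + suc (p + q)) ∸ (tri (p + q) + q)
      ≡⟨ [m+n]∸[m+o]≡n∸o (tri (p + q)) (suc (p + q)) q ⟩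
    suc p + q ∸ q
      ≡⟨ m+n∸n≡m (suc p) q ⟩
    suc p
      ∎

-- 2e = k(k+1) - 2j
twiceEdges : ℕ → ℕ → ℕ
twiceEdges p q = (p + q) * (p + q) + p + 3 * q

degSquares : ℕ → ℕ → ℕ
degSquares p q = suc p * ((p + q) * (p + q)) + q * (suc (p + q) * suc (p + q)) + q * q

Cqc-coordinates : ∀ v e → Σ ℕ λ p → Σ ℕ λ q →
  Cqc v e ≡ degSquares p q × 2 * e ≡ twiceEdges p q
Cqc-coordinates v e with coordinates e
... | p , q , k≡ , j≡ , e≡ = p , q , C≡ , E≡
  where
  C≡ : Cqc v e ≡ degSquares p q
  C≡ rewrite j≡ | suc-injective k≡ | m+n∸m≡n p q = refl
  expand : ∀ p q → (p + q) * (1 + (p + q)) + 2 * q ≡ (p + q) * (p + q) + p + 3 * q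
  expand = solve-∀
  E≡ : 2 * e ≡ twiceEdges p q
  E≡ = begin
    2 * e                         ≡⟨ cong (2 *_) e≡ ⟩
    2 * (tri (p + q) + q)         ≡⟨ *-distribˡ-+ 2 (tri (p + q)) q ⟩
    2 * tri (p + q) + 2 * q       ≡⟨ cong (_+ 2 * q) (tri-double (p + q)) ⟩
    (p + q) * suc (p + q) + 2 * q ≡⟨ expand p q ⟩
    twiceEdges p q                ∎
    where open ≡-Reasoning

sum-squares-shifted : ∀ y d → 2 * (y * (y + d)) ≤ y * y + (y + d) * (y + d)
sum-squares-shifted y d = subst (2 * (y * (y + d)) ≤_) (sym (expand y d)) (m≤m+n _ (d * d))
  where
  expand : ∀ y d → y * y + (y + d) * (y + d) ≡ 2 * (y * (y + d)) + d * d
  expand = solve-∀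

two-mul≤sum-squares : ∀ x y → 2 * (x * y) ≤ x * x + y * y
two-mul≤sum-squares x y with ≤-total x y
... | inj₁ x≤y = subst (λ z → 2 * (x * z) ≤ x * x + z * z) (m+[n∸m]≡n x≤y)
                   (sum-squares-shifted x (y ∸ x))
... | inj₂ y≤x = subst₂ _≤_ (cong (2 *_) (*-comm y x)) (+-comm (y * y) (x * x))
                   (subst (λ z → 2 * (y * z) ≤ y * y + z * z) (m+[n∸m]≡n y≤x)
                     (sum-squares-shifted y (x ∸ y)))

am-gm : ∀ x y → 4 * (x * y) ≤ (x + y) * (x + y)
am-gm x y = subst₂ _≤_ (double x y) (square x y)
              (+-monoˡ-≤ (2 * (x * y)) (two-mul≤sum-squares x y))
  where
  double : ∀ x y → 2 * (x * y) + 2 * (x * y) ≡ 4 * (x * y)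
  double = solve-∀
  square : ∀ x y → x * x + y * y + 2 * (x * y) ≡ (x + y) * (x + y)
  square = solve-∀

-- Tangent-line bound for a square root: since √y ≤ (a² + y)/(2a), any T with
-- E (a² + y) ≤ a T satisfies 2E√y ≤ T, i.e. 4E²y ≤ T².
tangent-bound : ∀ a E y T .{{_ : NonZero a}} →
  E * (a * a + y) ≤ a * T → 4 * (E * E * y) ≤ T * T
tangent-bound a E y T hyp = *-cancelˡ-≤ (a * a) {{m*n≢0 a a}} (begin
  a * a * (4 * (E * E * y))           ≡⟨ regroup₁ a E y ⟩
  E * E * (4 * (a * a * y))           ≤⟨ *-monoʳ-≤ (E * E) (am-gm (a * a) y) ⟩
  E * E * ((a * a + y) * (a * a + y)) ≡⟨ regroup₂ a E y ⟩
  E * (a * a + y) * (E * (a * a + y)) ≤⟨ *-mono-≤ hyp hyp ⟩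
  a * T * (a * T)                     ≡⟨ regroup₃ a T ⟩
  a * a * (T * T)                     ∎)
  where
  open ≤-Reasoning
  regroup₁ : ∀ a E y → a * a * (4 * (E * E * y)) ≡ E * E * (4 * (a * a * y))
  regroup₁ = solve-∀
  regroup₂ : ∀ a E y → E * E * ((a * a + y) * (a * a + y)) ≡ E * (a * a + y) * (E * (a * a + y))
  regroup₂ = solve-∀
  regroup₃ : ∀ a T → a * T * (a * T) ≡ a * a * (T * T)
  regroup₃ = solve-∀

m≤m*m : ∀ m → m ≤ m * m
m≤m*m zero      = z≤n
m≤m*m m@(suc _) = m≤m*n m m

-- The point a = 2k + 1 at which the tangent line is taken; a² ≥ 8e + 1.
tangentPoint : ℕ → ℕ → ℕ
tangentPoint p q = 3 + 2 * (p + q)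

-- a (4C + 3E) - E (a² + 4E + 1) = 2(p+q)(p-q)² + p(p-1) + q² + 9q + 6pq; to stay
-- in ℕ the negative parts 4pq(p+q) + p are moved to the left-hand side.
polynomial-identity : ∀ p q →
  let s = p + q ; a = 3 + 2 * s ; E = s * s + p + 3 * q
      C = (1 + p) * (s * s) + q * ((1 + s) * (1 + s)) + q * q in
  a * (4 * C + 3 * E) + (2 * (p + q) * (2 * (p * q)) + p)
    ≡ E * (a * a + (4 * E + 1))
      + (2 * (p + q) * (p * p + q * q) + p * p + (q * q + 9 * q + 6 * (p * q)))
polynomial-identity = solve-∀

-- The moved terms are dominated: 2pq ≤ p² + q² and p ≤ p².
remainder-bound : ∀ p q →
  2 * (p + q) * (2 * (p * q)) + p
    ≤ 2 * (p + q) * (p * p + q * q) + p * p + (q * q + 9 * q + 6 * (p * q))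
remainder-bound p q =
  ≤-trans (+-mono-≤ (*-monoʳ-≤ (2 * (p + q)) (two-mul≤sum-squares p q)) (m≤m*m p))
          (m≤m+n _ _)

polynomial-bound : ∀ p q →
  let a = tangentPoint p q ; E = twiceEdges p q in
  E * (a * a + (4 * E + 1)) ≤ a * (4 * degSquares p q + 3 * E)
polynomial-bound p q = +-cancelʳ-≤ _ _ _ (begin
  E * (a * a + (4 * E + 1)) + r ≤⟨ +-monoʳ-≤ (E * (a * a + (4 * E + 1))) (remainder-bound p q) ⟩
  E * (a * a + (4 * E + 1)) + s ≡⟨ sym (polynomial-identity p q) ⟩
  a * (4 * degSquares p q + 3 * E) + r ∎)
  where
  open ≤-Reasoning
  a = tangentPoint p q
  E = twiceEdges p q
  r = 2 * (p + q) * (2 * (p * q)) + p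
  s = 2 * (p + q) * (p * p + q * q) + p * p + (q * q + 9 * q + 6 * (p * q))

-- The squared form of C ≥ e (√(8e+1) - 3/2), written with E = 2e.
degSquares-bound : ∀ p q → let E = twiceEdges p q ; T = 4 * degSquares p q + 3 * E in
  4 * (E * E * (4 * E + 1)) ≤ T * T
degSquares-bound p q =
  tangent-bound (tangentPoint p q) E (4 * E + 1) (4 * degSquares p q + 3 * E) (polynomial-bound p q)
  where
  E = twiceEdges p q

GeL-intro : ∀ c e → 4 * (e * e) * (8 * e + 1) ≤ (2 * c + 3 * e) * (2 * c + 3 * e) →
  GeL (+ c) e
GeL-intro c e bound =
  subst (λ t → + 0 ℤ.≤ t × + (4 * (e * e) * (8 * e + 1)) ℤ.≤ t ℤ.* t) (sym t≡)
    (ℤ.+≤+ z≤n , subst (+ (4 * (e * e) * (8 * e + 1)) ℤ.≤_) (ℤP.pos-* N N) (ℤ.+≤+ bound))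
  where
  N = 2 * c + 3 * e
  t≡ : (+ 2) ℤ.* (+ c) ℤ.+ (+ (3 * e)) ≡ + N
  t≡ = sym (trans (ℤP.pos-+ (2 * c) (3 * e)) (cong (ℤ._+ (+ (3 * e))) (ℤP.pos-* 2 c)))

-- C(v,e) ≥ L(e).  This holds for every e.
Cqc-bound : ∀ v e → GeL (+ Cqc v e) e
Cqc-bound v e with Cqc-coordinates v e
... | p , q , C≡ , E≡ =
  GeL-intro (Cqc v e) e (*-cancelˡ-≤ 4 (subst₂ _≤_ (halve₁ e) (halve₂ (Cqc v e) e) doubled))
  where
  doubled : 4 * (2 * e * (2 * e) * (4 * (2 * e) + 1))
              ≤ (4 * Cqc v e + 3 * (2 * e)) * (4 * Cqc v e + 3 * (2 * e))
  doubled = subst₂ (λ E Q → 4 * (E * E * (4 * E + 1)) ≤ (4 * Q + 3 * E) * (4 * Q + 3 * E))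
              (sym E≡) (sym C≡) (degSquares-bound p q)
  halve₁ : ∀ e → 4 * (2 * e * (2 * e) * (4 * (2 * e) + 1)) ≡ 4 * (4 * (e * e) * (8 * e + 1))
  halve₁ = solve-∀
  halve₂ : ∀ c e → (4 * c + 3 * (2 * e)) * (4 * c + 3 * (2 * e)) ≡ 4 * ((2 * c + 3 * e) * (2 * c + 3 * e))
  halve₂ = solve-∀

lemma5 : (v e : ℕ) → 1 ≤ v → 3 ≤ e → e ≤ v C 2 →
    GeL (+ Cqc v e) e
    × GeLPlus (Sqs v e) ((v C 2) ∸ e)
        ((+ (v ∸ 1)) ℤ.* ((+ (4 * e)) ℤ.- (+ (v * (v ∸ 1)))))
lemma5 v e _ _ _ =
  Cqc-bound v e , subst (λ a → GeL a e') (sym (//-rightDividesʳ b (+ Cqc v e'))) (Cqc-bound v e')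
  where
  e' = (v C 2) ∸ e
  b = (+ (v ∸ 1)) ℤ.* ((+ (4 * e)) ℤ.- (+ (v * (v ∸ 1))))
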